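{- Let $\alpha, x$ be superadditive arithmetic functions with positive integer values, and let $\beta, y$ be arithmetic functions with positive integer values. Then $n!_{\alpha,\beta}=n!_{x,y}$ for all $n\geq 1$ if and only if \[\Delta\alpha\star \mathrm{Log}(\beta)=\Delta x\star \mathrm{Log}(y).\]
   Context: An arithmetic function $x:\mathbb{Z}_{\geq1}\to\mathbb{Z}_{>0}$ is superadditive if $x(m)+x(n)\leq x(m+n)$ for all $m,n\geq1$. For superadditive $x$ and positive-integer-valued $y$, the factorial generated by $(x,y)$ is $n!_{x,y}:=\prod_{k=1}^{n}y(k)^{x(\lfloor n/k\rfloor)}$ for $n\geq1$ (and $0!_{x,y}=1$). The difference function is $\Delta\alpha(n):=\alpha(n)-\alpha(n-1)$ for $n\geq1$ with the convention $\alpha(0)=0$. $\mathrm{Log}(\beta)(n):=\log(\beta(n))$. The Dirichlet convolution is $(f\star g)(n)=\sum_{d\mid n}f(n/d)g(d)$. -}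

module Defs where

open import Data.Nat using (ℕ; zero; suc; _+_; _*_; _∸_; _^_; _≤_; _<_; _/_)
open import Data.Nat.Divisibility using (_∣?_)
open import Data.List using (List; applyUpTo; filter; map)
open import Data.Nat.ListAction using (product)

-- Arithmetic functions are modelled as ℕ → ℕ; only values at n ≥ 1 matter.

Positive : (ℕ → ℕ) → Set
Positive f = ∀ n → 1 ≤ n → 0 < f n

Superadditive : (ℕ → ℕ) → Set
Superadditive f = ∀ m n → 1 ≤ m → 1 ≤ n → f m + f n ≤ f (m + n)

range1 : ℕ → List ℕ
range1 n = applyUpTo suc n

-- n !_{x,y} = ∏_{k=1}^{n} y(k)^{x(⌊n/k⌋)}   (empty product = 1, so 0! = 1)
factorial : (ℕ → ℕ) → (ℕ → ℕ) → ℕ → ℕ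
factorial x y n = product (map (λ k → y k ^ x (n / suc (k ∸ 1))) (range1 n))

ext0 : (ℕ → ℕ) → ℕ → ℕ
ext0 f zero    = 0
ext0 f (suc n) = f (suc n)

-- Δf(n) = f(n) − f(n−1), with f(0) = 0.  (Truncated subtraction; exact for
-- superadditive positive f, which is nondecreasing.)
Δ : (ℕ → ℕ) → ℕ → ℕ
Δ f zero    = 0
Δ f (suc n) = f (suc n) ∸ ext0 f n

divisors : ℕ → List ℕ
divisors n = filter (_∣? n) (range1 n)

-- exp((Δα ⋆ Log β)(n)) = ∏_{d ∣ n} β(d)^{Δα(n/d)}
expConv : (ℕ → ℕ) → (ℕ → ℕ) → ℕ → ℕ
expConv α β n = product (map (λ d → β d ^ Δ α (n / suc (d ∸ 1))) (divisors n))

{-# OPTIONS --safe #-}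
-- Since ⌊(n+1)/k⌋ = ⌊n/k⌋ + [k ∣ n+1], extending x by x(0) = 0 gives
-- x(⌊(n+1)/k⌋) = x(⌊n/k⌋) + [k ∣ n+1] · Δx(⌊(n+1)/k⌋) for every k ≥ 1, because a
-- superadditive x is nondecreasing.  Multiplying the factors y(k)^… over k ≤ n+1 yields
-- (n+1)!_{x,y} = n!_{x,y} · exp((Δx ⋆ Log y)(n+1)).  Hence equal factorials give equal
-- convolutions by cancelling the positive n!_{α,β}, and conversely by induction on n.
module Submission where

open import Defs
open import Data.Nat using (ℕ; _≤_)
open import Relation.Binary.PropositionalEquality using (_≡_)
open import Function.Bundles using (_⇔_)

open import Data.Bool using (true; false; if_then_else_)
open import Data.List using (List; []; _∷_; map; filter; applyUpTo; [_]; _++_)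
open import Data.List.Properties using (applyUpTo-∷ʳ; map-++)
open import Data.Nat using (zero; suc; _+_; _*_; _∸_; _^_; _<_; _/_; _%_; NonZero; z≤n; s≤s; >-nonZero)
open import Data.Nat.DivMod using (m≡m%n+[m/n]*n; m%n<n; /-congˡ; +-distrib-/-∣ʳ; m<n⇒m/n≡0; m*n/n≡m; m≥n⇒m/n>0)
open import Data.Nat.Divisibility using (_∣_; _∣?_; divides)
open import Data.Nat.ListAction using (product)
open import Data.Nat.ListAction.Properties using (product-++)
open import Data.Nat.Properties
open import Algebra.Properties.CommutativeSemigroup *-commutativeSemigroup
  using () renaming (interchange to *-interchange)
open import Function using (_∘′_)
open import Function.Bundles using (mk⇔)
open import Relation.Binary.PropositionalEquality using (refl; sym; trans; cong; cong₂; module ≡-Reasoning)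
open import Relation.Nullary using (¬_; yes; no; does)
open import Relation.Nullary.Decidable using (dec-true; dec-false)
open import Relation.Unary using (Pred; Decidable)

open ≡-Reasoning

productUpTo : (ℕ → ℕ) → ℕ → ℕ
productUpTo f n = product (map f (range1 n))

productUpTo-suc : ∀ f n → productUpTo f (suc n) ≡ productUpTo f n * f (suc n)
productUpTo-suc f n = begin
  product (map f (applyUpTo suc (suc n)))
    ≡⟨ cong (product ∘′ map f) (applyUpTo-∷ʳ suc n) ⟨
  product (map f (applyUpTo suc n ++ [ suc n ]))
    ≡⟨ cong product (map-++ f (applyUpTo suc n) [ suc n ]) ⟩
  product (map f (applyUpTo suc n) ++ [ f (suc n) ])
    ≡⟨ product-++ (map f (applyUpTo suc n)) [ f (suc n) ] ⟩
  productUpTo f n * (f (suc n) * 1)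
    ≡⟨ cong (productUpTo f n *_) (*-identityʳ (f (suc n))) ⟩
  productUpTo f n * f (suc n) ∎

productUpTo-cong : ∀ f g n → (∀ k → k < n → f (suc k) ≡ g (suc k)) →
                   productUpTo f n ≡ productUpTo g n
productUpTo-cong f g zero    f≗g = refl
productUpTo-cong f g (suc n) f≗g = begin
  productUpTo f (suc n)       ≡⟨ productUpTo-suc f n ⟩
  productUpTo f n * f (suc n) ≡⟨ cong₂ _*_ (productUpTo-cong f g n (λ k k<n → f≗g k (m<n⇒m<1+n k<n)))
                                           (f≗g n ≤-refl) ⟩
  productUpTo g n * g (suc n) ≡⟨ productUpTo-suc g n ⟨
  productUpTo g (suc n)       ∎

productUpTo-* : ∀ f g n → productUpTo (λ k → f k * g k) n ≡ productUpTo f n * productUpTo g n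
productUpTo-* f g zero    = refl
productUpTo-* f g (suc n) = begin
  productUpTo (λ k → f k * g k) (suc n)
    ≡⟨ productUpTo-suc (λ k → f k * g k) n ⟩
  productUpTo (λ k → f k * g k) n * (f (suc n) * g (suc n))
    ≡⟨ cong (_* (f (suc n) * g (suc n))) (productUpTo-* f g n) ⟩
  (productUpTo f n * productUpTo g n) * (f (suc n) * g (suc n))
    ≡⟨ *-interchange (productUpTo f n) (productUpTo g n) (f (suc n)) (g (suc n)) ⟩
  (productUpTo f n * f (suc n)) * (productUpTo g n * g (suc n))
    ≡⟨ cong₂ _*_ (productUpTo-suc f n) (productUpTo-suc g n) ⟨
  productUpTo f (suc n) * productUpTo g (suc n) ∎

productUpTo-pos : ∀ f n → (∀ k → 0 < f (suc k)) → 0 < productUpTo f n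
productUpTo-pos f zero    f>0 = s≤s z≤n
productUpTo-pos f (suc n) f>0 rewrite productUpTo-suc f n =
  *-mono-< (productUpTo-pos f n f>0) (f>0 n)

product-map-filter : ∀ {p} {P : Pred ℕ p} (P? : Decidable P) (g : ℕ → ℕ) (ks : List ℕ) →
  product (map g (filter P? ks)) ≡ product (map (λ k → if does (P? k) then g k else 1) ks)
product-map-filter P? g []       = refl
product-map-filter P? g (k ∷ ks) with does (P? k)
... | true  = cong (g k *_) (product-map-filter P? g ks)
... | false = trans (product-map-filter P? g ks) (sym (*-identityˡ _))

[r+q*n]/n≡q : ∀ r q {n} .{{_ : NonZero n}} → r < n → (r + q * n) / n ≡ q
[r+q*n]/n≡q r q {n} r<n = begin
  (r + q * n) / n   ≡⟨ +-distrib-/-∣ʳ r (divides q refl) ⟩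
  r / n + q * n / n ≡⟨ cong₂ _+_ (m<n⇒m/n≡0 r<n) (m*n/n≡m q n) ⟩
  q                 ∎

[1+m]/n≡1+m/n : ∀ m {n} .{{_ : NonZero n}} → n ∣ suc m → suc m / n ≡ suc (m / n)
[1+m]/n≡1+m/n m {suc k} (divides (suc q) 1+m≡[1+q]*n) = begin
  suc m / suc k                 ≡⟨ /-congˡ 1+m≡[1+q]*n ⟩
  suc q * suc k / suc k         ≡⟨ m*n/n≡m (suc q) (suc k) ⟩
  suc q                         ≡⟨ cong suc ([r+q*n]/n≡q k q ≤-refl) ⟨
  suc ((k + q * suc k) / suc k) ≡⟨ cong (λ i → suc (i / suc k)) (suc-injective 1+m≡[1+q]*n) ⟨
  suc (m / suc k)               ∎

[1+m]/n≡m/n : ∀ m {n} .{{_ : NonZero n}} → ¬ n ∣ suc m → suc m / n ≡ m / n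
[1+m]/n≡m/n m {n} n∤1+m = begin
  suc m / n                         ≡⟨ /-congˡ (cong suc (m≡m%n+[m/n]*n m n)) ⟩
  (suc (m % n) + (m / n) * n) / n   ≡⟨ [r+q*n]/n≡q (suc (m % n)) (m / n) 1+r<n ⟩
  m / n                             ∎
  where
  1+r<n : suc (m % n) < n
  1+r<n = ≤∧≢⇒< (m%n<n m n) λ 1+r≡n →
    n∤1+m (divides (suc (m / n)) (trans (cong suc (m≡m%n+[m/n]*n m n))
                                        (cong (_+ (m / n) * n) 1+r≡n)))

superadditive⇒ext0-mono : ∀ {x} → Superadditive x → ∀ m → ext0 x m ≤ ext0 x (suc m)
superadditive⇒ext0-mono     sa zero    = z≤n
superadditive⇒ext0-mono {x} sa (suc m) =
  ≤-trans (m≤n+m (x (suc m)) (x 1)) (sa 1 (suc m) (s≤s z≤n) (s≤s z≤n))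

ext0-/-suc-∣ : ∀ {x} → (∀ m → ext0 x m ≤ ext0 x (suc m)) → ∀ n {k} .{{_ : NonZero k}} →
               k ∣ suc n → ext0 x (suc n / k) ≡ ext0 x (n / k) + Δ x (suc n / k)
ext0-/-suc-∣ {x} mono n {k} k∣1+n = begin
  ext0 x (suc n / k)                   ≡⟨ cong (ext0 x) ([1+m]/n≡1+m/n n k∣1+n) ⟩
  ext0 x (suc (n / k))                 ≡⟨ m+[n∸m]≡n (mono (n / k)) ⟨
  ext0 x (n / k) + Δ x (suc (n / k))   ≡⟨ cong (λ i → ext0 x (n / k) + Δ x i) ([1+m]/n≡1+m/n n k∣1+n) ⟨
  ext0 x (n / k) + Δ x (suc n / k)     ∎

factorialTerm : (ℕ → ℕ) → (ℕ → ℕ) → ℕ → ℕ → ℕ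
factorialTerm x y n k = y k ^ ext0 x (n / suc (k ∸ 1))

expConvTerm : (ℕ → ℕ) → (ℕ → ℕ) → ℕ → ℕ → ℕ
expConvTerm x y n k = if does (k ∣? n) then y k ^ Δ x (n / suc (k ∸ 1)) else 1

expConvTerm-∣ : ∀ x y {n k} → k ∣ n → expConvTerm x y n k ≡ y k ^ Δ x (n / suc (k ∸ 1))
expConvTerm-∣ x y {n} {k} k∣n = cong (if_then y k ^ Δ x (n / suc (k ∸ 1)) else 1) (dec-true (k ∣? n) k∣n)

expConvTerm-∤ : ∀ x y {n k} → ¬ k ∣ n → expConvTerm x y n k ≡ 1
expConvTerm-∤ x y {n} {k} k∤n = cong (if_then y k ^ Δ x (n / suc (k ∸ 1)) else 1) (dec-false (k ∣? n) k∤n)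

expConv≡productUpTo : ∀ x y n → expConv x y n ≡ productUpTo (expConvTerm x y n) n
expConv≡productUpTo x y n = product-map-filter (_∣? n) (λ d → y d ^ Δ x (n / suc (d ∸ 1))) (range1 n)

factorial≡productUpTo : ∀ x y n → factorial x y n ≡ productUpTo (factorialTerm x y n) n
factorial≡productUpTo x y n = productUpTo-cong _ (factorialTerm x y n) n λ k k<n →
  cong (y (suc k) ^_) (ext0-pos (m≥n⇒m/n>0 {n} {suc k} k<n))
  where
  ext0-pos : ∀ {i} → 0 < i → x i ≡ ext0 x i
  ext0-pos {suc i} _ = refl

-- The factor k = n + 1 has exponent x(0) = 0.
productUpTo-factorialTerm-suc : ∀ x y n →
  productUpTo (factorialTerm x y n) (suc n) ≡ productUpTo (factorialTerm x y n) n
productUpTo-factorialTerm-suc x y n = begin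
  productUpTo (factorialTerm x y n) (suc n)
    ≡⟨ productUpTo-suc (factorialTerm x y n) n ⟩
  productUpTo (factorialTerm x y n) n * y (suc n) ^ ext0 x (n / suc n)
    ≡⟨ cong (λ i → productUpTo (factorialTerm x y n) n * y (suc n) ^ ext0 x i) (m<n⇒m/n≡0 (n<1+n n)) ⟩
  productUpTo (factorialTerm x y n) n * 1
    ≡⟨ *-identityʳ _ ⟩
  productUpTo (factorialTerm x y n) n ∎

factorialTerm-suc : ∀ x y → (∀ m → ext0 x m ≤ ext0 x (suc m)) → ∀ n k →
  factorialTerm x y (suc n) (suc k) ≡ factorialTerm x y n (suc k) * expConvTerm x y (suc n) (suc k)
factorialTerm-suc x y mono n k with suc k ∣? suc n
... | yes k∣1+n = begin
  y (suc k) ^ ext0 x (suc n / suc k)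
    ≡⟨ cong (y (suc k) ^_) (ext0-/-suc-∣ mono n k∣1+n) ⟩
  y (suc k) ^ (ext0 x (n / suc k) + Δ x (suc n / suc k))
    ≡⟨ ^-distribˡ-+-* (y (suc k)) (ext0 x (n / suc k)) _ ⟩
  y (suc k) ^ ext0 x (n / suc k) * y (suc k) ^ Δ x (suc n / suc k)
    ≡⟨ cong (y (suc k) ^ ext0 x (n / suc k) *_) (expConvTerm-∣ x y k∣1+n) ⟨
  factorialTerm x y n (suc k) * expConvTerm x y (suc n) (suc k) ∎
... | no k∤1+n = begin
  y (suc k) ^ ext0 x (suc n / suc k)
    ≡⟨ cong (λ i → y (suc k) ^ ext0 x i) ([1+m]/n≡m/n n k∤1+n) ⟩
  y (suc k) ^ ext0 x (n / suc k)
    ≡⟨ *-identityʳ _ ⟨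
  y (suc k) ^ ext0 x (n / suc k) * 1
    ≡⟨ cong (y (suc k) ^ ext0 x (n / suc k) *_) (expConvTerm-∤ x y k∤1+n) ⟨
  factorialTerm x y n (suc k) * expConvTerm x y (suc n) (suc k) ∎

factorial-suc : ∀ x y → Superadditive x → ∀ n →
                factorial x y (suc n) ≡ factorial x y n * expConv x y (suc n)
factorial-suc x y sa n = begin
  factorial x y (suc n)
    ≡⟨ factorial≡productUpTo x y (suc n) ⟩
  productUpTo (factorialTerm x y (suc n)) (suc n)
    ≡⟨ productUpTo-cong (factorialTerm x y (suc n)) (λ k → factorialTerm x y n k * expConvTerm x y (suc n) k) (suc n)
                        (λ k _ → factorialTerm-suc x y (superadditive⇒ext0-mono sa) n k) ⟩
  productUpTo (λ k → factorialTerm x y n k * expConvTerm x y (suc n) k) (suc n)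
    ≡⟨ productUpTo-* (factorialTerm x y n) (expConvTerm x y (suc n)) (suc n) ⟩
  productUpTo (factorialTerm x y n) (suc n) * productUpTo (expConvTerm x y (suc n)) (suc n)
    ≡⟨ cong₂ _*_ (trans (productUpTo-factorialTerm-suc x y n) (sym (factorial≡productUpTo x y n)))
                 (sym (expConv≡productUpTo x y (suc n))) ⟩
  factorial x y n * expConv x y (suc n) ∎

factorial-pos : ∀ x y → Positive y → ∀ n → 0 < factorial x y n
factorial-pos x y py n = productUpTo-pos _ n λ k →
  m^n>0 (y (suc k)) {{>-nonZero (py (suc k) (s≤s z≤n))}} (x (n / suc k))

expConv-≡⇒factorial-≡ : ∀ {α β x y} → Superadditive α → Superadditive x →
  (∀ n → 1 ≤ n → expConv α β n ≡ expConv x y n) → ∀ n → factorial α β n ≡ factorial x y n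
expConv-≡⇒factorial-≡                     saα sax eq zero    = refl
expConv-≡⇒factorial-≡ {α} {β} {x} {y} saα sax eq (suc n) = begin
  factorial α β (suc n)                 ≡⟨ factorial-suc α β saα n ⟩
  factorial α β n * expConv α β (suc n) ≡⟨ cong₂ _*_ (expConv-≡⇒factorial-≡ saα sax eq n) (eq (suc n) (s≤s z≤n)) ⟩
  factorial x y n * expConv x y (suc n) ≡⟨ factorial-suc x y sax n ⟨
  factorial x y (suc n)                 ∎

factorial-≡⇒expConv-≡ : ∀ {α β x y} → Superadditive α → Superadditive x → Positive β →
  (∀ n → factorial α β n ≡ factorial x y n) → ∀ n → 1 ≤ n → expConv α β n ≡ expConv x y n
factorial-≡⇒expConv-≡ {α} {β} {x} {y} saα sax pβ eq (suc n) _ =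
  *-cancelˡ-≡ _ _ (factorial α β n) {{>-nonZero (factorial-pos α β pβ n)}} (begin
    factorial α β n * expConv α β (suc n) ≡⟨ factorial-suc α β saα n ⟨
    factorial α β (suc n)                 ≡⟨ eq (suc n) ⟩
    factorial x y (suc n)                 ≡⟨ factorial-suc x y sax n ⟩
    factorial x y n * expConv x y (suc n) ≡⟨ cong (_* expConv x y (suc n)) (eq n) ⟨
    factorial α β n * expConv x y (suc n) ∎)

mainTheorem4 : (α β x y : ℕ → ℕ) →
    Superadditive α → Positive α → Superadditive x → Positive x →
    Positive β → Positive y →
    ((∀ n → 1 ≤ n → factorial α β n ≡ factorial x y n) ⇔
     (∀ n → 1 ≤ n → expConv α β n ≡ expConv x y n))
mainTheorem4 α β x y saα _ sax _ pβ _ = mk⇔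
  (λ eq → factorial-≡⇒expConv-≡ saα sax pβ (λ where zero → refl ; n@(suc _) → eq n (s≤s z≤n)))
  (λ eq n _ → expConv-≡⇒factorial-≡ saα sax eq n)
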